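{- Let $H$ be a $2$-edge-connected undirected graph and $T$ a DFS tree of $H$ rooted at $r$, with vertices identified with their DFS numbers. Let $u,v\neq r$ be vertices such that $v$ is an ancestor of $u$. Then $H\setminus\{(u,p(u)),(v,p(v))\}$ is not connected if and only if $v$ is a proper ancestor of $u$, $M(u)=M(v)$, and $\mathit{high}(u)<v$.
   Context: Vertices are numbered in DFS discovery order and identified with these numbers. Every vertex is an ancestor and descendant of itself; $p(x)$ is the parent of $x$. Edges not in $T$ are back-edges, each joining a vertex to an ancestor. For $x\neq r$: $\mathit{high}(x)$ is the maximum proper ancestor of $x$ joined by a back-edge to a descendant of $x$; $M(x)$ is the nearest common ancestor of all descendants of $x$ joined by a back-edge to a proper ancestor of $x$ (both well-defined since $H$ is $2$-edge-connected). $H\setminus\{e,e'\}$ is obtained by deleting the edges $e,e'$. -}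

module Defs where

open import Data.Nat using (ℕ; suc)
import Data.Nat as ℕ
open import Data.Fin using (Fin; zero; suc; toℕ)
open import Data.List using (List; length; lookup)
open import Data.Product using (Σ; ∃; _×_; _,_; proj₁; proj₂)
open import Data.Sum using (_⊎_; inj₁; inj₂)
open import Data.Empty using (⊥-elim)
open import Data.Unit using (⊤)
open import Relation.Binary.PropositionalEquality using (_≡_; _≢_; refl)

-- A graph H on the vertex set Fin (suc n), presented together with a
-- rooted spanning tree T whose vertices are identified with their numbers.  Vertex (suc i) is a non-root vertex whose
-- parent p(suc i) is  par i .  The edges of H are the tree edges
-- (suc i , par i)  (one per non-root vertex) together with the
-- (multi)set of non-tree edges  back  (each listed as (descendant , ancestor)).
record Graph (n : ℕ) : Set where
  field
    par  : Fin n → Fin (suc n)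
    back : List (Fin (suc n) × Fin (suc n))

open Graph public

V : ℕ → Set
V n = Fin (suc n)

root : ∀ {n} → V n
root = zero

data Anc {n : ℕ} (G : Graph n) : V n → V n → Set where
  anc-refl : ∀ {x} → Anc G x x
  anc-step : ∀ {a i} → Anc G a (par G i) → Anc G a (suc i)

ProperAnc : ∀ {n} → Graph n → V n → V n → Set
ProperAnc G a x = Anc G a x × a ≢ x

Edge : ∀ {n} → Graph n → Set
Edge {n} G = Fin n ⊎ Fin (length (back G))

ends : ∀ {n} (G : Graph n) → Edge G → V n × V n
ends G (inj₁ i) = (suc i , par G i)
ends G (inj₂ k) = lookup (back G) k

pedge : ∀ {n} (G : Graph n) (x : V n) → x ≢ root → Edge G
pedge G zero    h = ⊥-elim (h refl)
pedge G (suc i) h = inj₁ i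

-- T is a DFS tree of H with vertices numbered in DFS discovery order:
--  * parents are discovered before children,
--  * the numbering is a preorder of T (the descendants of every vertex x
--    form the contiguous interval starting at x),
--  * every non-tree edge joins a vertex to one of its ancestors.
record IsDFSTree {n : ℕ} (G : Graph n) : Set where
  field
    par-lt   : ∀ i → toℕ (par G i) ℕ.< toℕ (suc {n} i)
    preorder : ∀ x y z → Anc G x z → toℕ x ℕ.≤ toℕ y → toℕ y ℕ.≤ toℕ z → Anc G x y
    back-anc : ∀ k → Anc G (proj₂ (lookup (back G) k)) (proj₁ (lookup (back G) k))

data Reach {n : ℕ} (G : Graph n) (P : Edge G → Set) : V n → V n → Set where
  here : ∀ {x} → Reach G P x x
  fwd  : ∀ {z} (e : Edge G) → P e → Reach G P (proj₂ (ends G e)) z → Reach G P (proj₁ (ends G e)) z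
  bwd  : ∀ {z} (e : Edge G) → P e → Reach G P (proj₁ (ends G e)) z → Reach G P (proj₂ (ends G e)) z

ConnectedSub : ∀ {n} (G : Graph n) → (Edge G → Set) → Set
ConnectedSub {n} G P = ∀ (x y : V n) → Reach G P x y

Connected : ∀ {n} → Graph n → Set
Connected G = ConnectedSub G (λ _ → ⊤)

Without1 : ∀ {n} (G : Graph n) → Edge G → Edge G → Set
Without1 G e f = f ≢ e

Without2 : ∀ {n} (G : Graph n) → Edge G → Edge G → Edge G → Set
Without2 G e e' f = f ≢ e × f ≢ e'

TwoEdgeConnected : ∀ {n} → Graph n → Set
TwoEdgeConnected G = Connected G × (∀ e → ConnectedSub G (Without1 G e))

BackOut : ∀ {n} (G : Graph n) → V n → V n → V n → Set
BackOut G x d a =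
  Σ (Fin (length (back G))) λ k → lookup (back G) k ≡ (d , a) × Anc G x d × ProperAnc G a x

IsHigh : ∀ {n} → Graph n → V n → V n → Set
IsHigh G x h = (∃ λ d → BackOut G x d h) × (∀ d a → BackOut G x d a → toℕ a ℕ.≤ toℕ h)

CommonAnc : ∀ {n} → Graph n → V n → V n → Set
CommonAnc G x c = ∀ d a → BackOut G x d a → Anc G c d

IsM : ∀ {n} → Graph n → V n → V n → Set
IsM G x m = CommonAnc G x m × (∀ c → CommonAnc G x c → Anc G c m)

module Submission where

open import Defs
open import Data.Nat using (ℕ)
import Data.Nat as ℕ
open import Data.Fin using (toℕ)
open import Data.Product using (∃; _×_)
open import Relation.Nullary using (¬_)
open import Relation.Binary.PropositionalEquality using (_≢_)
open import Function.Bundles using (_⇔_)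

open import Data.Nat using (_≤_; _<_; s≤s)
open import Data.Nat.Properties
  using (≤-refl; ≤-trans; <⇒≤; ≤-<-trans; <-≤-trans; ≤-antisym; <-irrefl; <⇒≱; ≤∧≢⇒<; ≰⇒>; _≤?_)
open import Data.Fin using (Fin; zero; suc)
open import Data.Fin.Properties using (toℕ-injective; suc-injective; 0≢1+n; any?; all?; _≟_)
open import Data.Product using (Σ; _,_; proj₁; proj₂)
open import Data.Sum using (_⊎_; inj₁; inj₂)
open import Data.Empty using (⊥-elim)
open import Data.List using (length; lookup)
open import Relation.Nullary using (Dec; yes; no)
open import Relation.Nullary.Decidable using (map′; decidable-stable; _→-dec_; _×-dec_; ¬?)
open import Relation.Unary using (Decidable)
open import Relation.Binary.PropositionalEquality using (_≡_; refl; sym; cong; subst; ≢-sym)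
open import Function.Bundles using (mk⇔; Equivalence)

-- For a vertex x let B(x) be the set of back-edges leaving the subtree T(x),
-- i.e. joining a descendant of x to a proper ancestor of x.  Both high(x) and
-- M(x) only depend on B(x), and the proof is routed through the condition
-- B(u) = B(v):
--
--  * Cut lemma: for v a proper ancestor of u, deleting (u,p(u)) and (v,p(v))
--    disconnects H iff B(u) = B(v).  If B(u) = B(v), no remaining edge
--    leaves T(v) \ T(u), so v is cut off from the root.  Conversely, a
--    back-edge in B(u) \ B(v) or in B(v) \ B(u), together with the edges of
--    B(u) and B(v) (non-empty by 2-edge-connectivity), lets u and v, hence
--    every vertex, reach the root.
--  * Translation: if B(u) is non-empty and v is a proper ancestor of u, then
--    B(u) = B(v) iff M(u) = M(v) and high(u) < v.
--  * Deleting the same tree edge twice leaves H connected, so u ≠ v.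

max-witness : ∀ {m} (P : Fin m → Set) → Decidable P → (f : Fin m → ℕ) → ∃ P →
  Σ (Fin m) λ k → P k × (∀ j → P j → f j ≤ f k)
max-witness {ℕ.zero} P P? f (() , _)
max-witness {ℕ.suc m} P P? f w₀ with any? (λ k → P? (suc k))
max-witness {ℕ.suc m} P P? f (zero , p₀) | no none =
  zero , p₀ , λ { zero _ → ≤-refl ; (suc j) pj → ⊥-elim (none (j , pj)) }
max-witness {ℕ.suc m} P P? f (suc k , pk) | no none = ⊥-elim (none (k , pk))
max-witness {ℕ.suc m} P P? f _ | yes w
  with max-witness (λ k → P (suc k)) (λ k → P? (suc k)) (λ k → f (suc k)) w | P? zero
... | k , pk , k-max | no ¬p₀ =
  suc k , pk , λ { zero p₀ → ⊥-elim (¬p₀ p₀) ; (suc j) pj → k-max j pj }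
... | k , pk , k-max | yes p₀ with f zero ≤? f (suc k)
...   | yes z≤k = suc k , pk , λ { zero _ → z≤k ; (suc j) pj → k-max j pj }
...   | no z≰k = zero , p₀ , λ { zero _ → ≤-refl
                               ; (suc j) pj → ≤-trans (k-max j pj) (<⇒≤ (≰⇒> z≰k)) }

module DFSTree {n : ℕ} (G : Graph n) (dfs : IsDFSTree G) where
  open IsDFSTree dfs

  anc⇒≤ : ∀ {a x} → Anc G a x → toℕ a ≤ toℕ x
  anc⇒≤ anc-refl = ≤-refl
  anc⇒≤ (anc-step {i = i} p) = <⇒≤ (≤-<-trans (anc⇒≤ p) (par-lt i))

  proper⇒< : ∀ {a x} → ProperAnc G a x → toℕ a < toℕ x
  proper⇒< (ax , a≢x) = ≤∧≢⇒< (anc⇒≤ ax) (λ eq → a≢x (toℕ-injective eq))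

  anc-trans : ∀ {a b c} → Anc G a b → Anc G b c → Anc G a c
  anc-trans ab anc-refl = ab
  anc-trans ab (anc-step bc) = anc-step (anc-trans ab bc)

  anc-antisym : ∀ {a b} → Anc G a b → Anc G b a → a ≡ b
  anc-antisym ab ba = toℕ-injective (≤-antisym (anc⇒≤ ab) (anc⇒≤ ba))

  proper-anc-trans : ∀ {a b c} → ProperAnc G a b → Anc G b c → ProperAnc G a c
  proper-anc-trans (ab , a≢b) bc = anc-trans ab bc , λ { refl → a≢b (anc-antisym ab bc) }

  proper⇒¬desc : ∀ {a x} → ProperAnc G a x → ¬ Anc G x a
  proper⇒¬desc (ax , a≢x) xa = a≢x (anc-antisym ax xa)

  anc-comparable : ∀ {a b x} → Anc G a x → Anc G b x → Anc G a b ⊎ Anc G b a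
  anc-comparable anc-refl bx = inj₂ bx
  anc-comparable (anc-step ax) anc-refl = inj₁ (anc-step ax)
  anc-comparable (anc-step ax) (anc-step bx) = anc-comparable ax bx

  above-of-chain : ∀ {a b x} → Anc G a x → Anc G b x → ¬ Anc G b a → ProperAnc G a b
  above-of-chain ax bx ¬ba with anc-comparable ax bx
  ... | inj₁ ab = ab , λ { refl → ¬ba anc-refl }
  ... | inj₂ ba = ⊥-elim (¬ba ba)

  anc-root : ∀ {a} → Anc G a root → a ≡ root
  anc-root anc-refl = refl

  proper⇒anc-parent : ∀ {a i} → ProperAnc G a (suc i) → Anc G a (par G i)
  proper⇒anc-parent (anc-refl , a≢a) = ⊥-elim (a≢a refl)
  proper⇒anc-parent (anc-step p , _) = p

  anc-parent⇒proper : ∀ {a i} → Anc G a (par G i) → ProperAnc G a (suc i)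
  anc-parent⇒proper {i = i} ap = anc-step ap , λ a≡x → <-irrefl (cong toℕ a≡x) (≤-<-trans (anc⇒≤ ap) (par-lt i))

  -- Ancestry is decidable and the root is above every vertex; both follow the
  -- parent chain, whose length is bounded by the DFS number.
  anc? : ∀ a x → Dec (Anc G a x)
  anc? a x = search (ℕ.suc (toℕ x)) x ≤-refl
    where
    search : ∀ bound y → toℕ y < bound → Dec (Anc G a y)
    search bound y _ with a ≟ y
    ... | yes refl = yes anc-refl
    search _ zero _ | no a≢y = no λ ay → a≢y (anc-root ay)
    search (ℕ.suc bound) (suc i) (s≤s y<) | no a≢y =
      map′ anc-step (λ ay → proper⇒anc-parent (ay , a≢y))
           (search bound (par G i) (<-≤-trans (par-lt i) y<))

  root-anc : ∀ x → Anc G root x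
  root-anc x = climb (ℕ.suc (toℕ x)) x ≤-refl
    where
    climb : ∀ bound y → toℕ y < bound → Anc G root y
    climb _ zero _ = anc-refl
    climb (ℕ.suc bound) (suc i) (s≤s y<) = anc-step (climb bound (par G i) (<-≤-trans (par-lt i) y<))

  edge-anc : ∀ e → Anc G (proj₂ (ends G e)) (proj₁ (ends G e))
  edge-anc (inj₁ i) = anc-step anc-refl
  edge-anc (inj₂ k) = back-anc k

  module _ {P : Edge G → Set} where
    reach-trans : ∀ {x y z} → Reach G P x y → Reach G P y z → Reach G P x z
    reach-trans here q = q
    reach-trans (fwd e p r) q = fwd e p (reach-trans r q)
    reach-trans (bwd e p r) q = bwd e p (reach-trans r q)

    reach-sym : ∀ {x y} → Reach G P x y → Reach G P y x
    reach-sym here = here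
    reach-sym (fwd e p r) = reach-trans (reach-sym r) (bwd e p here)
    reach-sym (bwd e p r) = reach-trans (reach-sym r) (fwd e p here)

  reach-mono : ∀ {P Q : Edge G → Set} → (∀ f → P f → Q f) →
    ∀ {x y} → Reach G P x y → Reach G Q x y
  reach-mono P⊆Q here = here
  reach-mono P⊆Q (fwd e p r) = fwd e (P⊆Q e p) (reach-mono P⊆Q r)
  reach-mono P⊆Q (bwd e p r) = bwd e (P⊆Q e p) (reach-mono P⊆Q r)

  delete-twice : TwoEdgeConnected G → ∀ e → ConnectedSub G (Without2 G e e)
  delete-twice (_ , tec) e x y = reach-mono (λ f f≢e → f≢e , f≢e) (tec e x y)

  BackEdge : Set
  BackEdge = Fin (length (back G))

  lower upper : BackEdge → V n
  lower k = proj₁ (lookup (back G) k)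
  upper k = proj₂ (lookup (back G) k)

  Leaves : V n → BackEdge → Set
  Leaves x k = Anc G x (lower k) × ProperAnc G (upper k) x

  leaves? : ∀ x k → Dec (Leaves x k)
  leaves? x k = anc? x (lower k) ×-dec (anc? (upper k) x ×-dec ¬? (upper k ≟ x))

  backOut⇒leaves : ∀ {x d a} → BackOut G x d a →
    Σ BackEdge λ k → lookup (back G) k ≡ (d , a) × Leaves x k
  backOut⇒leaves (k , refl , xd , ax) = k , refl , xd , ax

  leaves⇒backOut : ∀ {x} k → Leaves x k → BackOut G x (lower k) (upper k)
  leaves⇒backOut k (xd , ax) = k , refl , xd , ax

  backOut-proper : ∀ {x d a} → BackOut G x d a → ProperAnc G a x
  backOut-proper (_ , _ , _ , ax) = ax

  SameLeaves : V n → V n → Set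
  SameLeaves x y = ∀ k → Leaves x k ⇔ Leaves y k

  backOut-mono : ∀ {x y} → (∀ k → Leaves x k → Leaves y k) →
    ∀ {d a} → BackOut G x d a → BackOut G y d a
  backOut-mono B⊆ bo with backOut⇒leaves bo
  ... | k , refl , xk = leaves⇒backOut k (B⊆ k xk)

  high-exists : ∀ {x} → ∃ (Leaves x) → ∃ (IsHigh G x)
  high-exists {x} b with max-witness (Leaves x) (leaves? x) (λ k → toℕ (upper k)) b
  ... | k , xk , k-max = upper k , (lower k , leaves⇒backOut k xk) , highest
    where
    highest : ∀ d a → BackOut G x d a → toℕ a ≤ toℕ (upper k)
    highest d a bo with backOut⇒leaves bo
    ... | j , refl , xj = k-max j xj

  commonAnc? : ∀ x c → Dec (CommonAnc G x c)
  commonAnc? x c =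
    map′ (λ all-k d a bo → common d a bo all-k) (λ ca k xk → ca _ _ (leaves⇒backOut k xk))
         (all? λ k → leaves? x k →-dec anc? c (lower k))
    where
    common : ∀ d a → BackOut G x d a → (∀ k → Leaves x k → Anc G c (lower k)) → Anc G c d
    common d a bo all-k with backOut⇒leaves bo
    ... | k , refl , xk = all-k k xk

  -- M(x) exists once B(x) is non-empty: the deepest common ancestor; it is
  -- nearest since all common ancestors lie on the root path of one lower end.
  M-exists : ∀ {x} → ∃ (Leaves x) → ∃ (IsM G x)
  M-exists {x} (k , xk) with max-witness (CommonAnc G x) (commonAnc? x) toℕ (root , λ d _ _ → root-anc d)
  ... | m , m-common , m-max = m , m-common , nearest
    where
    nearest : ∀ c → CommonAnc G x c → Anc G c m
    nearest c c-common
      with anc-comparable (c-common _ _ (leaves⇒backOut k xk)) (m-common _ _ (leaves⇒backOut k xk))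
    ... | inj₁ cm = cm
    ... | inj₂ mc = subst (λ t → Anc G t m) (toℕ-injective (≤-antisym (anc⇒≤ mc) (m-max c c-common))) anc-refl

  -- M(x) is a descendant of x, since x itself is a common ancestor.
  M-desc : ∀ {x m} → IsM G x m → Anc G x m
  M-desc (_ , nearest) = nearest _ λ _ _ (_ , _ , xd , _) → xd

  M-transfer : ∀ {x y m} → SameLeaves x y → IsM G x m → IsM G y m
  M-transfer same (m-common , nearest) =
    (λ d a bo → m-common d a (backOut-mono (λ k → Equivalence.from (same k)) bo)) ,
    (λ c c-common → nearest c λ d a bo → c-common d a (backOut-mono (λ k → Equivalence.to (same k)) bo))

  sameLeaves⇒M-high : ∀ {u v} → ∃ (Leaves u) → SameLeaves u v →
    (∃ λ m → IsM G u m × IsM G v m) × (∃ λ h → IsHigh G u h × toℕ h < toℕ v)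
  sameLeaves⇒M-high b same with M-exists b | high-exists b
  ... | m , Mu | h , Hu@((_ , bo) , _) =
    (m , Mu , M-transfer same Mu) ,
    (h , Hu , proper⇒< (backOut-proper (backOut-mono (λ k → Equivalence.to (same k)) bo)))

  M-high⇒sameLeaves : ∀ {u v m h} → ProperAnc G v u → IsM G u m → IsM G v m →
    IsHigh G u h → toℕ h < toℕ v → SameLeaves u v
  M-high⇒sameLeaves {u} {v} v-above-u Mu Mv (_ , highest) h<v k = mk⇔ u⇒v v⇒u
    where
    -- the upper end lies below high(u) < v on the root path of u
    u⇒v : Leaves u k → Leaves v k
    u⇒v uk@(ud , au , _) = anc-trans (proj₁ v-above-u) ud , above-of-chain au (proj₁ v-above-u) ¬va
      where
      a<v : toℕ (upper k) < toℕ v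
      a<v = ≤-<-trans (highest _ _ (leaves⇒backOut k uk)) h<v
      ¬va : ¬ Anc G v (upper k)
      ¬va va = <⇒≱ a<v (anc⇒≤ va)
    -- the lower end lies below M(v) = M(u), a descendant of u
    v⇒u : Leaves v k → Leaves u k
    v⇒u vk@(_ , av) =
      anc-trans (M-desc Mu) (proj₁ Mv _ _ (leaves⇒backOut k vk)) , proper-anc-trans av (proj₁ v-above-u)

  module _ {i : Fin n} where
    private
      w : V n
      w = suc i

    crossing : ∀ e → e ≢ inj₁ i → Anc G w (proj₁ (ends G e)) → ¬ Anc G w (proj₂ (ends G e)) → ∃ (Leaves w)
    crossing (inj₁ j) e≢ wx ¬wy with w ≟ suc j
    ... | yes eq = ⊥-elim (e≢ (cong inj₁ (sym (suc-injective eq))))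
    ... | no w≢x = ⊥-elim (¬wy (proper⇒anc-parent (wx , w≢x)))
    crossing (inj₂ k) _ wx ¬wy = k , wx , above-of-chain (back-anc k) wx ¬wy

    escape : ∀ {x z} → Reach G (Without1 G (inj₁ i)) x z → Anc G w x → ¬ Anc G w z → ∃ (Leaves w)
    escape here wx ¬wz = ⊥-elim (¬wz wx)
    escape (fwd e e≢ r) wx ¬wz with anc? w (proj₂ (ends G e))
    ... | yes wy = escape r wy ¬wz
    ... | no ¬wy = crossing e e≢ wx ¬wy
    escape (bwd e _ r) wy ¬wz = escape r (anc-trans wy (edge-anc e)) ¬wz

  leaves-exist : TwoEdgeConnected G → ∀ i → ∃ (Leaves (suc i))
  leaves-exist (_ , tec) i =
    escape (tec (inj₁ i) (suc i) root) anc-refl (λ w-root → 0≢1+n (sym (anc-root w-root)))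

  module CutPair (iu iv : Fin n) (v-above-u : ProperAnc G (suc iv) (suc iu)) where
    u v : V n
    u = suc iu
    v = suc iv

    Kept : Edge G → Set
    Kept = Without2 G (inj₁ iu) (inj₁ iv)

    _~_ : V n → V n → Set
    _~_ = Reach G Kept

    ¬u-above-v : ¬ Anc G u v
    ¬u-above-v = proper⇒¬desc v-above-u

    back-kept : ∀ k → Kept (inj₂ k)
    back-kept k = (λ ()) , (λ ())

    tree-kept : ∀ {i} → suc i ≢ u → suc i ≢ v → Kept (inj₁ i)
    tree-kept x≢u x≢v = (λ { refl → x≢u refl }) , (λ { refl → x≢v refl })

    kept-tree : ∀ {i} → Kept (inj₁ i) → suc i ≢ u × suc i ≢ v
    kept-tree (e≢eu , e≢ev) = (λ eq → e≢eu (cong inj₁ (suc-injective eq))) ,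
                              (λ eq → e≢ev (cong inj₁ (suc-injective eq)))

    -- Sufficiency: if B(u) = B(v), no kept edge leaves T(v) \ T(u).
    Between : V n → Set
    Between x = Anc G v x × ¬ Anc G u x

    module _ (same : SameLeaves u v) where
      up-closed : ∀ e → Kept e → Between (proj₁ (ends G e)) → Between (proj₂ (ends G e))
      up-closed (inj₁ i) kept (vx , ¬ux) =
        proper⇒anc-parent (vx , ≢-sym (proj₂ (kept-tree kept))) , λ uy → ¬ux (anc-step uy)
      up-closed (inj₂ k) _ (vd , ¬ud) with anc? v (upper k)
      ... | yes va = va , λ ua → ¬ud (anc-trans ua (back-anc k))
      ... | no ¬va = ⊥-elim (¬ud (proj₁ (Equivalence.from (same k) (vd , above-of-chain (back-anc k) vd ¬va))))

      down-closed : ∀ e → Kept e → Between (proj₂ (ends G e)) → Between (proj₁ (ends G e))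
      down-closed (inj₁ i) kept (vy , ¬uy) =
        anc-step vy , λ ux → ¬uy (proper⇒anc-parent (ux , ≢-sym (proj₁ (kept-tree kept))))
      down-closed (inj₂ k) _ (va , ¬ua) = anc-trans va (back-anc k) , ¬ud
        where
        ¬ud : ¬ Anc G u (lower k)
        ¬ud ud = proper⇒¬desc (proj₂ (Equivalence.to (same k) (ud , above-of-chain (back-anc k) ud ¬ua))) va

      between-invariant : ∀ {x z} → x ~ z → Between x → Between z
      between-invariant here bx = bx
      between-invariant (fwd e kept r) bx = between-invariant r (up-closed e kept bx)
      between-invariant (bwd e kept r) bx = between-invariant r (down-closed e kept bx)

      sameLeaves⇒disconnected : ¬ ConnectedSub G Kept
      sameLeaves⇒disconnected conn =
        0≢1+n (sym (anc-root (proj₁ (between-invariant (conn v root) (anc-refl , ¬u-above-v)))))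

    climb : ∀ {w x} → Anc G w x → (∀ y → Anc G y x → ProperAnc G w y → y ≢ u × y ≢ v) → x ~ w
    climb anc-refl _ = here
    climb (anc-step {i = i} wp) avoids with avoids (suc i) anc-refl (anc-parent⇒proper wp)
    ... | x≢u , x≢v = fwd (inj₁ i) (tree-kept x≢u x≢v) (climb wp λ y yp wy → avoids y (anc-step yp) wy)

    climb-to-u : ∀ {x} → Anc G u x → x ~ u
    climb-to-u ux = climb ux λ y _ uy → (λ { refl → proj₂ uy refl }) , λ { refl → ¬u-above-v (proj₁ uy) }

    climb-to-v : ∀ {x} → Anc G v x → ¬ Anc G u x → x ~ v
    climb-to-v vx ¬ux = climb vx λ y yx vy → (λ { refl → ¬ux yx }) , λ { refl → proj₂ vy refl }

    climb-to-root : ∀ {x} → ¬ Anc G v x → x ~ root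
    climb-to-root ¬vx = climb (root-anc _) λ y yx _ →
      (λ { refl → ¬vx (anc-trans (proj₁ v-above-u) yx) }) , λ { refl → ¬vx yx }

    connected-via-root : u ~ root → v ~ root → ConnectedSub G Kept
    connected-via-root u~r v~r x y = reach-trans (to-root x) (reach-sym (to-root y))
      where
      to-root : ∀ x → x ~ root
      to-root x with anc? u x | anc? v x
      ... | yes ux | _ = reach-trans (climb-to-u ux) u~r
      ... | no ¬ux | yes vx = reach-trans (climb-to-v vx ¬ux) v~r
      ... | no _ | no ¬vx = climb-to-root ¬vx

    -- a back-edge of B(v) \ B(u): it starts in T(v) \ T(u)
    connected-by-v-edge : ∃ (Leaves u) → ∀ k → Leaves v k → ¬ Anc G u (lower k) → ConnectedSub G Kept
    connected-by-v-edge (k₁ , ud₁ , a₁u) k (vd , av) ¬ud = connected-via-root u~r v~r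
      where
      v~r : v ~ root
      v~r = reach-trans (reach-sym (climb-to-v vd ¬ud)) (fwd (inj₂ k) (back-kept k) (climb-to-root (proper⇒¬desc av)))
      outside-u : ∀ {x} → ¬ Anc G u x → x ~ root
      outside-u {x} ¬ux with anc? v x
      ... | yes vx = reach-trans (climb-to-v vx ¬ux) v~r
      ... | no ¬vx = climb-to-root ¬vx
      u~r : u ~ root
      u~r = reach-trans (reach-sym (climb-to-u ud₁)) (fwd (inj₂ k₁) (back-kept k₁) (outside-u (proper⇒¬desc a₁u)))

    -- a back-edge of B(u) \ B(v): it lands in T(v) \ T(u), joining u to v
    connected-by-u-edge : ∃ (Leaves v) → ∀ k → Leaves u k → Anc G v (upper k) → ConnectedSub G Kept
    connected-by-u-edge (k₂ , vd₂ , a₂v) k (ud , au) va =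
      connected-via-root (reach-trans u~v v~r) v~r
      where
      u~v : u ~ v
      u~v = reach-trans (reach-sym (climb-to-u ud)) (fwd (inj₂ k) (back-kept k) (climb-to-v va (proper⇒¬desc au)))
      inside-v : ∀ {x} → Anc G v x → x ~ v
      inside-v {x} vx with anc? u x
      ... | yes ux = reach-trans (climb-to-u ux) u~v
      ... | no ¬ux = climb-to-v vx ¬ux
      v~r : v ~ root
      v~r = reach-trans (reach-sym (inside-v vd₂)) (fwd (inj₂ k₂) (back-kept k₂) (climb-to-root (proper⇒¬desc a₂v)))

    disconnected⇒sameLeaves : TwoEdgeConnected G → ¬ ConnectedSub G Kept → SameLeaves u v
    disconnected⇒sameLeaves tec cut k = mk⇔ u⇒v v⇒u
      where
      u⇒v : Leaves u k → Leaves v k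
      u⇒v uk@(ud , au) = anc-trans (proj₁ v-above-u) ud ,
        above-of-chain (proj₁ au) (proj₁ v-above-u) (λ va → cut (connected-by-u-edge (leaves-exist tec iv) k uk va))
      v⇒u : Leaves v k → Leaves u k
      v⇒u vk@(_ , av) =
        decidable-stable (anc? u (lower k)) (λ ¬ud → cut (connected-by-v-edge (leaves-exist tec iu) k vk ¬ud)) ,
        proper-anc-trans av (proj₁ v-above-u)

  cut-pair-distinct : TwoEdgeConnected G → ∀ {i j} →
    ¬ ConnectedSub G (Without2 G (inj₁ i) (inj₁ j)) → suc j ≢ suc i
  cut-pair-distinct tec {i} cut refl = cut (delete-twice tec (inj₁ i))

proposition7 : ∀ {n} (G : Graph n) → IsDFSTree G → TwoEdgeConnected G →
    (u v : V n) (u≢r : u ≢ root) (v≢r : v ≢ root) → Anc G v u →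
    ((¬ ConnectedSub G (Without2 G (pedge G u u≢r) (pedge G v v≢r)))
    ⇔ (ProperAnc G v u
    × (∃ λ m → IsM G u m × IsM G v m)
    × (∃ λ h → IsHigh G u h × toℕ h ℕ.< toℕ v)))
proposition7 G dfs tec zero _ u≢r _ _ = ⊥-elim (u≢r refl)
proposition7 G dfs tec (suc _) zero _ v≢r _ = ⊥-elim (v≢r refl)
proposition7 G dfs tec (suc iu) (suc iv) _ _ v-anc-u = mk⇔
  (λ cut → let v-above-u = v-anc-u , cut-pair-distinct tec cut in
    v-above-u ,
    sameLeaves⇒M-high (leaves-exist tec iu) (CutPair.disconnected⇒sameLeaves iu iv v-above-u tec cut))
  (λ (v-above-u , (_ , Mu , Mv) , (_ , Hu , h<v)) →
    CutPair.sameLeaves⇒disconnected iu iv v-above-u (M-high⇒sameLeaves v-above-u Mu Mv Hu h<v))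
  where open DFSTree G dfs
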